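{- Let $c$ and $d$ be positive integers. There exist graphs $G_1$ and $G_2$ such that $\chi_d^=(G_1) - \chi(G_1) > c$ and $\chi(G_2) - \chi_d^=(G_2) > c$.
   Context: All graphs are finite, simple and undirected. An exact $(k,d)$-coloring of $G=(V,E)$ is a map $c: V\to\{1,\dots,k\}$ such that every vertex has exactly $d$ neighbors of its own color; $\chi_d^=(G)$ is the least $k$ for which one exists ($\infty$ if none). $\chi(G)$ denotes the chromatic number. -}

module Defs where

open import Data.Nat using (ℕ; _<_)
open import Data.Bool using (Bool; true; false; _∧_)
open import Data.Fin using (Fin; _≟_)
open import Data.List using (length; filterᵇ)
open import Data.List using () renaming (allFin to allFinL)
open import Relation.Nullary using (¬_; does)
open import Relation.Binary.PropositionalEquality using (_≡_; _≢_)
open import Data.Product using (Σ; _×_)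

record Graph : Set where
  field
    n     : ℕ
    adj   : Fin n → Fin n → Bool
    sym   : ∀ u v → adj u v ≡ adj v u
    irefl : ∀ v → adj v v ≡ false
open Graph public

Coloring : Graph → ℕ → Set
Coloring G k = Fin (n G) → Fin k

Proper : (G : Graph) {k : ℕ} → Coloring G k → Set
Proper G col = ∀ u v → adj G u v ≡ true → col u ≢ col v

sameColorDeg : (G : Graph) {k : ℕ} → Coloring G k → Fin (n G) → ℕ
sameColorDeg G col v =
  length (filterᵇ (λ u → adj G v u ∧ does (col u ≟ col v)) (allFinL (n G)))

ExactColoring : (G : Graph) (k d : ℕ) → Coloring G k → Set
ExactColoring G k d col = ∀ v → sameColorDeg G col v ≡ d

IsChromaticNumber : Graph → ℕ → Set
IsChromaticNumber G k =
  Σ (Coloring G k) (Proper G) ×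
  (∀ j → j < k → ¬ Σ (Coloring G j) (Proper G))

-- χ_d^=(G) = k (finite) : an exact (k,d)-coloring exists and none with fewer colors
IsExactChromaticNumber : Graph → ℕ → ℕ → Set
IsExactChromaticNumber G d k =
  Σ (Coloring G k) (ExactColoring G k d) ×
  (∀ j → j < k → ¬ Σ (Coloring G j) (ExactColoring G j d))

-- In the complete graph on t(d+1) vertices an exact d-coloring is precisely a partition
-- into classes of size d+1, so χ_d^= = t while χ = t(d+1). In the complete bipartite graph
-- K_{td,td} a color class meeting one side meets the other side in exactly d vertices, each
-- of which then sees the whole class on the first side; so every class meets each side in
-- 0 or d vertices, and χ_d^= = t while χ = 2. Both lower bounds χ_d^= ≥ t count vertices
-- as the sum of the sizes of the color classes.
module Submission where

open import Defs hiding (sym)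

open import Data.Bool using (Bool; true; false; not; _∧_)
open import Data.Fin using (Fin; zero; suc; _≟_; _↑ˡ_; _↑ʳ_; splitAt; quotient)
open import Data.Fin.Properties
  using (splitAt-↑ˡ; splitAt-↑ʳ; splitAt⁻¹-↑ˡ; splitAt⁻¹-↑ʳ; pigeonhole; <⇒≢)
open import Data.List using (length; filterᵇ; tabulate)
open import Data.Nat using (ℕ; zero; suc; _+_; _*_; _<_; _≤_; z≤n; s≤s)
open import Data.Nat.Properties
  using ( +-0-commutativeMonoid; +-identityʳ; +-suc; +-assoc; +-comm; suc-injective
        ; +-mono-≤; +-monoʳ-≤; +-monoˡ-<; n<1+n; m≤m*n; ≤-reflexive; <⇒≱; *-cancelʳ-≤; *-suc
        ; module ≤-Reasoning)
open import Algebra.Properties.CommutativeMonoid.Sum +-0-commutativeMonoid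
  using (sum-syntax; ∑-distrib-+; sum-cong-≗; sum-replicate-zero)
open import Data.Product using (Σ; ∃; _×_; _,_)
open import Data.Sum using (_⊎_; inj₁; inj₂; [_,_]′)
open import Function using (_∘_; id; const)
open import Relation.Binary.PropositionalEquality
  using (_≡_; _≗_; refl; sym; trans; cong; cong₂; subst; module ≡-Reasoning)
open import Relation.Nullary using (¬_; does; yes; no)
open import Relation.Nullary.Decidable using (dec-true; dec-false)

indicator : Bool → ℕ
indicator true  = 1
indicator false = 0

count : ∀ {m} → (Fin m → Bool) → ℕ
count {m} P = ∑[ i < m ] indicator (P i)

fibreSize : ∀ {m k} → (Fin m → Fin k) → Fin k → ℕ
fibreSize f γ = count (λ u → does (f u ≟ γ))

length-filterᵇ-tabulate : ∀ {m} {A : Set} (P : A → Bool) (f : Fin m → A) →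
  length (filterᵇ P (tabulate f)) ≡ count (P ∘ f)
length-filterᵇ-tabulate {zero}  P f = refl
length-filterᵇ-tabulate {suc m} P f with P (f zero)
... | true  = cong suc (length-filterᵇ-tabulate P (f ∘ suc))
... | false = length-filterᵇ-tabulate P (f ∘ suc)

count-cong : ∀ {m} {P Q : Fin m → Bool} → P ≗ Q → count P ≡ count Q
count-cong P≗Q = sum-cong-≗ (cong indicator ∘ P≗Q)

count-false : ∀ m → count {m} (const false) ≡ 0
count-false m = sum-replicate-zero m

count-true : ∀ m → count {m} (const true) ≡ m
count-true zero    = refl
count-true (suc m) = cong suc (count-true m)

count-↑ : ∀ m {n} (P : Fin (m + n) → Bool) →
  count P ≡ count (P ∘ (_↑ˡ n)) + count (P ∘ (m ↑ʳ_))
count-↑ zero    P = refl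
count-↑ (suc m) P = trans (cong (indicator (P zero) +_) (count-↑ m (P ∘ suc)))
                          (sym (+-assoc (indicator (P zero)) _ _))

count-remove : ∀ {m} (v : Fin m) (P : Fin m → Bool) → P v ≡ true →
  count P ≡ suc (count (λ u → not (does (v ≟ u)) ∧ P u))
count-remove zero    P Pv rewrite Pv = refl
count-remove (suc v) P Pv =
  trans (cong (indicator (P zero) +_) (count-remove v (P ∘ suc) Pv)) (+-suc _ _)

count≡0⊎∃ : ∀ {m} (P : Fin m → Bool) → count P ≡ 0 ⊎ ∃ λ u → P u ≡ true
count≡0⊎∃ {zero}  P = inj₁ refl
count≡0⊎∃ {suc m} P with P zero in P0≡true | count≡0⊎∃ (P ∘ suc)
... | true  | _                = inj₂ (zero , P0≡true)
... | false | inj₁ count≡0     = inj₁ count≡0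
... | false | inj₂ (u , Pu≡true) = inj₂ (suc u , Pu≡true)

∑-≤-* : ∀ {k s} (g : Fin k → ℕ) → (∀ i → g i ≤ s) → ∑[ i < k ] g i ≤ k * s
∑-≤-* {zero}  g g≤s = z≤n
∑-≤-* {suc k} g g≤s = +-mono-≤ (g≤s zero) (∑-≤-* (g ∘ suc) (g≤s ∘ suc))

does-≟-comm : ∀ {k} (x y : Fin k) → does (x ≟ y) ≡ does (y ≟ x)
does-≟-comm x y with x ≟ y
... | yes x≡y = sym (dec-true (y ≟ x) (sym x≡y))
... | no  x≢y = sym (dec-false (y ≟ x) (x≢y ∘ sym))

does-≟⇒≡ : ∀ {k} (x y : Fin k) → does (x ≟ y) ≡ true → x ≡ y
does-≟⇒≡ x y _ with x ≟ y
does-≟⇒≡ x y _  | yes x≡y = x≡y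
does-≟⇒≡ x y () | no  _

∑-indicator-≟ : ∀ {k} (x : Fin k) → ∑[ γ < k ] indicator (does (x ≟ γ)) ≡ 1
∑-indicator-≟ {suc k} zero    = cong suc (sum-replicate-zero k)
∑-indicator-≟ {suc k} (suc x) = ∑-indicator-≟ x

∑-fibreSize : ∀ {m k} (f : Fin m → Fin k) → ∑[ γ < k ] fibreSize f γ ≡ m
∑-fibreSize {zero}  {k} f = sum-replicate-zero k
∑-fibreSize {suc m} {k} f = begin
  ∑[ γ < k ] fibreSize f γ
    ≡⟨ ∑-distrib-+ (λ γ → indicator (does (f zero ≟ γ))) (fibreSize (f ∘ suc)) ⟩
  ∑[ γ < k ] indicator (does (f zero ≟ γ)) + ∑[ γ < k ] fibreSize (f ∘ suc) γ
    ≡⟨ cong₂ _+_ (∑-indicator-≟ (f zero)) (∑-fibreSize (f ∘ suc)) ⟩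
  suc m ∎
  where open ≡-Reasoning

fibreSize-cong : ∀ {m k} {f g : Fin m → Fin k} {γ} → f ≗ g → fibreSize f γ ≡ fibreSize g γ
fibreSize-cong {γ = γ} f≗g = count-cong (λ u → cong (λ x → does (x ≟ γ)) (f≗g u))

fibreSize≡0⊎∃ : ∀ {m k} (f : Fin m → Fin k) γ → fibreSize f γ ≡ 0 ⊎ ∃ λ u → f u ≡ γ
fibreSize≡0⊎∃ f γ with count≡0⊎∃ (λ u → does (f u ≟ γ))
... | inj₁ fibre≡0  = inj₁ fibre≡0
... | inj₂ (u , eq) = inj₂ (u , does-≟⇒≡ (f u) γ eq)

fibreSize-≤ : ∀ {m k s} (f : Fin m → Fin k) →
  (∀ u → fibreSize f (f u) ≤ s) → ∀ γ → fibreSize f γ ≤ s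
fibreSize-≤ f bound γ with fibreSize≡0⊎∃ f γ
... | inj₁ fibre≡0    = subst (_≤ _) (sym fibre≡0) z≤n
... | inj₂ (u , refl) = bound u

pigeonhole-fibreSize : ∀ {m k s} (f : Fin m → Fin k) →
  (∀ u → fibreSize f (f u) ≤ s) → m ≤ k * s
pigeonhole-fibreSize {m} {k} {s} f bound = begin
  m                        ≡⟨ ∑-fibreSize f ⟨
  ∑[ γ < k ] fibreSize f γ ≤⟨ ∑-≤-* (fibreSize f) (fibreSize-≤ f bound) ⟩
  k * s                    ∎
  where open ≤-Reasoning

quotient-↑ˡ : ∀ {t} k (i : Fin k) → quotient {suc t} k (i ↑ˡ t * k) ≡ zero
quotient-↑ˡ {t} k i rewrite splitAt-↑ˡ k i (t * k) = refl

quotient-↑ʳ : ∀ {t} k (w : Fin (t * k)) → quotient {suc t} k (k ↑ʳ w) ≡ suc (quotient k w)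
quotient-↑ʳ {t} k w rewrite splitAt-↑ʳ k (t * k) w = refl

fibreSize-quotient : ∀ {t} k (γ : Fin t) → fibreSize (quotient {t} k) γ ≡ k
fibreSize-quotient {suc t} k γ = begin
  fibreSize (quotient k) γ
    ≡⟨ count-↑ k (λ u → does (quotient {suc t} k u ≟ γ)) ⟩
  fibreSize (quotient k ∘ (_↑ˡ t * k)) γ + fibreSize (quotient {suc t} k ∘ (k ↑ʳ_)) γ
    ≡⟨ cong₂ _+_ (fibreSize-cong (quotient-↑ˡ k)) (fibreSize-cong (quotient-↑ʳ {t} k)) ⟩
  fibreSize {k} (const zero) γ + fibreSize (suc ∘ quotient {t} k) γ
    ≡⟨ firstBlock+rest γ ⟩
  k ∎
  where
  open ≡-Reasoning
  firstBlock+rest : ∀ γ → fibreSize {k} (const zero) γ + fibreSize (suc ∘ quotient {t} k) γ ≡ k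
  firstBlock+rest zero    =
    trans (cong₂ _+_ (count-true k) (count-false (t * k))) (+-identityʳ k)
  firstBlock+rest (suc γ) =
    trans (cong (_+ fibreSize (quotient {t} k) γ) (count-false k)) (fibreSize-quotient k γ)

sameColorDeg≡count : (G : Graph) {k : ℕ} (col : Coloring G k) (v : Fin (n G)) →
  sameColorDeg G col v ≡ count (λ u → adj G v u ∧ does (col u ≟ col v))
sameColorDeg≡count G col v =
  length-filterᵇ-tabulate (λ u → adj G v u ∧ does (col u ≟ col v)) id

completeMultipartite : ∀ {m k} → (Fin m → Fin k) → Graph
completeMultipartite {m} f = record
  { n     = m
  ; adj   = λ u v → not (does (f u ≟ f v))
  ; sym   = λ u v → cong not (does-≟-comm (f u) (f v))
  ; irefl = λ v → cong not (dec-true (f v ≟ f v) refl)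
  }

proper-completeMultipartite : ∀ {m k} (f : Fin m → Fin k) → Proper (completeMultipartite f) f
proper-completeMultipartite f u v adjacent fu≡fv
  with () ← trans (sym (cong not (dec-true (f u ≟ f v) fu≡fv))) adjacent

complete : ℕ → Graph
complete m = completeMultipartite {m} id

suc-sameColorDeg-complete : ∀ {m k} (col : Coloring (complete m) k) v →
  suc (sameColorDeg (complete m) col v) ≡ fibreSize col (col v)
suc-sameColorDeg-complete col v =
  trans (cong suc (sameColorDeg≡count (complete _) col v))
        (sym (count-remove v _ (dec-true (col v ≟ col v) refl)))

chromaticNumber-complete : ∀ m → IsChromaticNumber (complete m) m
chromaticNumber-complete m = (id , proper-completeMultipartite id) , noProperColoring
  where
  noProperColoring : ∀ j → j < m → ¬ Σ (Coloring (complete m) j) (Proper (complete m))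
  noProperColoring j j<m (col , proper) with pigeonhole j<m col
  ... | u , v , u<v , colu≡colv =
    proper u v (cong not (dec-false (u ≟ v) (<⇒≢ u<v))) colu≡colv

exactChromaticNumber-complete : ∀ t d → IsExactChromaticNumber (complete (t * suc d)) d t
exactChromaticNumber-complete t d = (blocks , blocksExact) , noSmallerExact
  where
  G = complete (t * suc d)
  blocks : Coloring G t
  blocks = quotient (suc d)
  blocksExact : ExactColoring G t d blocks
  blocksExact v = suc-injective
    (trans (suc-sameColorDeg-complete blocks v) (fibreSize-quotient (suc d) (blocks v)))
  noSmallerExact : ∀ j → j < t → ¬ Σ (Coloring G j) (ExactColoring G j d)
  noSmallerExact j j<t (col , exact) =
    <⇒≱ j<t (*-cancelʳ-≤ t j (suc d) (pigeonhole-fibreSize col classSize))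
    where
    classSize : ∀ u → fibreSize col (col u) ≤ suc d
    classSize u = ≤-reflexive (trans (sym (suc-sameColorDeg-complete col u)) (cong suc (exact u)))

splitAt-elim : ∀ m {n} (P : Fin (m + n) → Set) →
  (∀ i → P (i ↑ˡ n)) → (∀ i → P (m ↑ʳ i)) → ∀ v → P v
splitAt-elim m P left right v with splitAt m v in eq
... | inj₁ i = subst P (splitAt⁻¹-↑ˡ eq) (left i)
... | inj₂ i = subst P (splitAt⁻¹-↑ʳ eq) (right i)

side : ∀ p → Fin (p + p) → Fin 2
side p = [ const zero , const (suc zero) ]′ ∘ splitAt p

side-↑ˡ : ∀ p i → side p (i ↑ˡ p) ≡ zero
side-↑ˡ p i rewrite splitAt-↑ˡ p i p = refl

side-↑ʳ : ∀ p i → side p (p ↑ʳ i) ≡ suc zero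
side-↑ʳ p i rewrite splitAt-↑ʳ p p i = refl

completeBipartite : ℕ → Graph
completeBipartite p = completeMultipartite (side p)

-- Stated for an arbitrary value s of side p v, so that once s is a known side the
-- adjacency test on each half reduces to a constant.
sameColorDeg-completeBipartite : ∀ p {k} (col : Coloring (completeBipartite p) k) v {s} →
  side p v ≡ s →
  sameColorDeg (completeBipartite p) col v
    ≡ count (λ w → not (does (s ≟ zero)) ∧ does (col (w ↑ˡ p) ≟ col v))
    + count (λ w → not (does (s ≟ suc zero)) ∧ does (col (p ↑ʳ w) ≟ col v))
sameColorDeg-completeBipartite p col v refl =
  trans (sameColorDeg≡count (completeBipartite p) col v)
    (trans (count-↑ p _)
      (cong₂ _+_ (count-cong (λ w → cong (adjacentSameColor (w ↑ˡ p)) (side-↑ˡ p w)))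
                 (count-cong (λ w → cong (adjacentSameColor (p ↑ʳ w)) (side-↑ʳ p w)))))
  where
  adjacentSameColor : Fin (p + p) → Fin 2 → Bool
  adjacentSameColor u s = not (does (side p v ≟ s)) ∧ does (col u ≟ col v)

sameColorDeg-↑ˡ : ∀ p {k} (col : Coloring (completeBipartite p) k) i →
  sameColorDeg (completeBipartite p) col (i ↑ˡ p) ≡ fibreSize (col ∘ (p ↑ʳ_)) (col (i ↑ˡ p))
sameColorDeg-↑ˡ p col i =
  trans (sameColorDeg-completeBipartite p col (i ↑ˡ p) (side-↑ˡ p i))
        (cong (_+ fibreSize (col ∘ (p ↑ʳ_)) (col (i ↑ˡ p))) (count-false p))

sameColorDeg-↑ʳ : ∀ p {k} (col : Coloring (completeBipartite p) k) i →
  sameColorDeg (completeBipartite p) col (p ↑ʳ i) ≡ fibreSize (col ∘ (_↑ˡ p)) (col (p ↑ʳ i))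
sameColorDeg-↑ʳ p col i =
  trans (sameColorDeg-completeBipartite p col (p ↑ʳ i) (side-↑ʳ p i))
        (trans (cong (fibreSize (col ∘ (_↑ˡ p)) (col (p ↑ʳ i)) +_) (count-false p)) (+-identityʳ _))

chromaticNumber-completeBipartite : ∀ q → IsChromaticNumber (completeBipartite (suc q)) 2
chromaticNumber-completeBipartite q =
  (side p , proper-completeMultipartite (side p)) , noProperColoring
  where
  p = suc q
  G = completeBipartite p
  Fin1-≡ : (x y : Fin 1) → x ≡ y
  Fin1-≡ zero zero = refl
  edge : adj G (zero ↑ˡ p) (p ↑ʳ zero) ≡ true
  edge = cong₂ (λ a b → not (does (a ≟ b))) (side-↑ˡ p zero) (side-↑ʳ p zero)
  noProperColoring : ∀ j → j < 2 → ¬ Σ (Coloring G j) (Proper G)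
  noProperColoring zero          _               (col , _) with () ← col zero
  noProperColoring (suc zero)    _               (col , proper) =
    proper (zero ↑ˡ p) (p ↑ʳ zero) edge (Fin1-≡ _ _)
  noProperColoring (suc (suc j)) (s≤s (s≤s ()))

exactChromaticNumber-completeBipartite : ∀ t d →
  IsExactChromaticNumber (completeBipartite (t * suc d)) (suc d) t
exactChromaticNumber-completeBipartite t d = (blocks , blocksExact) , noSmallerExact
  where
  p = t * suc d
  G = completeBipartite p
  blocks : Coloring G t
  blocks = [ quotient (suc d) , quotient (suc d) ]′ ∘ splitAt p
  blocks-↑ˡ : ∀ i → blocks (i ↑ˡ p) ≡ quotient (suc d) i
  blocks-↑ˡ i rewrite splitAt-↑ˡ p i p = refl
  blocks-↑ʳ : ∀ i → blocks (p ↑ʳ i) ≡ quotient (suc d) i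
  blocks-↑ʳ i rewrite splitAt-↑ʳ p p i = refl
  fibreSize-blocks : (e : Fin p → Fin (p + p)) → (∀ i → blocks (e i) ≡ quotient (suc d) i) →
    ∀ γ → fibreSize (blocks ∘ e) γ ≡ suc d
  fibreSize-blocks e blocks∘e≗quotient γ =
    trans (fibreSize-cong blocks∘e≗quotient) (fibreSize-quotient (suc d) γ)
  blocksExact : ExactColoring G t (suc d) blocks
  blocksExact = splitAt-elim p (λ v → sameColorDeg G blocks v ≡ suc d)
    (λ i → trans (sameColorDeg-↑ˡ p blocks i) (fibreSize-blocks (p ↑ʳ_) blocks-↑ʳ _))
    (λ i → trans (sameColorDeg-↑ʳ p blocks i) (fibreSize-blocks (_↑ˡ p) blocks-↑ˡ _))
  noSmallerExact : ∀ j → j < t → ¬ Σ (Coloring G j) (ExactColoring G j (suc d))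
  noSmallerExact j j<t (col , exact) =
    <⇒≱ j<t (*-cancelʳ-≤ t j (suc d) (pigeonhole-fibreSize (col ∘ (_↑ˡ p)) classOnLeft))
    where
    open ≡-Reasoning
    classOnLeft : ∀ u → fibreSize (col ∘ (_↑ˡ p)) (col (u ↑ˡ p)) ≤ suc d
    classOnLeft u with fibreSize≡0⊎∃ (col ∘ (p ↑ʳ_)) (col (u ↑ˡ p))
    ... | inj₁ none
      with () ← trans (sym (exact (u ↑ˡ p))) (trans (sameColorDeg-↑ˡ p col u) none)
    ... | inj₂ (w , colw≡colu) = ≤-reflexive (begin
      fibreSize (col ∘ (_↑ˡ p)) (col (u ↑ˡ p)) ≡⟨ cong (fibreSize (col ∘ (_↑ˡ p))) colw≡colu ⟨
      fibreSize (col ∘ (_↑ˡ p)) (col (p ↑ʳ w)) ≡⟨ sameColorDeg-↑ʳ p col w ⟨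
      sameColorDeg G col (p ↑ʳ w)              ≡⟨ exact (p ↑ʳ w) ⟩
      suc d                                    ∎)

n+[1+n]<[1+n]*[2+d] : ∀ n d → n + suc n < suc n * suc (suc d)
n+[1+n]<[1+n]*[2+d] n d = begin-strict
  n + suc n                   <⟨ +-monoˡ-< (suc n) (n<1+n n) ⟩
  suc n + suc n               ≤⟨ +-monoʳ-≤ (suc n) (m≤m*n (suc n) (suc d)) ⟩
  suc n + suc n * suc d       ≡⟨ *-suc (suc n) (suc d) ⟨
  suc n * suc (suc d)         ∎
  where open ≤-Reasoning

mainTheorem3 : (c d : ℕ) → 1 ≤ c → 1 ≤ d →
    (Σ Graph λ G₁ → Σ ℕ λ χ₁ → Σ ℕ λ χd₁ →
       IsChromaticNumber G₁ χ₁ × IsExactChromaticNumber G₁ d χd₁ × c + χ₁ < χd₁)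
    × (Σ Graph λ G₂ → Σ ℕ λ χ₂ → Σ ℕ λ χd₂ →
       IsChromaticNumber G₂ χ₂ × IsExactChromaticNumber G₂ d χd₂ × c + χd₂ < χ₂)
mainTheorem3 c (suc d) _ _ =
  ( completeBipartite (t₁ * suc d) , 2 , t₁
  , chromaticNumber-completeBipartite _
  , exactChromaticNumber-completeBipartite t₁ d
  , s≤s (≤-reflexive (+-comm c 2)) )
  , ( complete (t₂ * suc (suc d)) , t₂ * suc (suc d) , t₂
    , chromaticNumber-complete (t₂ * suc (suc d))
    , exactChromaticNumber-complete t₂ (suc d)
    , n+[1+n]<[1+n]*[2+d] c d )
  where
  t₁ = 3 + c
  t₂ = suc c
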